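{- Let $G_1$ and $G_2$ be graphs with independence numbers $\alpha_1 \geq \alpha_2$ and vertex sets $V_1$ and $V_2$. Let \begin{align*} b_j & \coloneqq \max \{j, \alpha_1+1-j\} \hbox{ and } \\ c_j & \coloneqq \max \{j, \alpha_1 + 1 - j + \sigma_{j - \alpha_2}(G_2)\}. \end{align*} \begin{enumerate} \item If $|V_2|\leq \alpha_1$ then \[\sigma(G_1 \vee G_2)=\min\left\{\sigma(G_1)\,,\displaystyle\min_{1 \leq j \leq \alpha_2} b_j\,,\displaystyle\min_{\alpha_2+1 \leq j \leq |V_2|} c_j\right\}.\] \item If $|V_2| \geq \alpha_1$ then \[\sigma(G_1 \vee G_2)=\min\left\{\sigma(G_1)\,,\displaystyle\min_{1 \leq j \leq \alpha_2} b_j\,,\displaystyle\min_{\alpha_2 +1 \leq j \leq \alpha_1} c_j\,,\,\sigma_{\alpha_1+1-\alpha_2}(G_2)\right\}.\] \end{enumerate}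
   Context: All graphs are finite, undirected and simple. $K_n$ is the complete graph and $\overline{K}_n$ the empty (edgeless) graph on $n$ vertices. $\alpha(G)$ is the independence number, $\Delta(G)$ the maximum degree, and $G_1\vee G_2$ the join (disjoint union plus all edges between the two graphs). For a nonempty graph $G=(V,E)$ the sensitivity is $\sigma(G)=\min\{\Delta(G[S]) : S\subseteq V,\ |S|>\alpha(G)\}$, and $\sigma(\overline{K}_n)=\infty$. For a nonempty graph $G$ and integer $k\le |V_G|-\alpha(G)$, the $k$-sensitivity is $\sigma_k(G)=0$ if $k\le 0$ and, for $1\le k\le |V_G|-\alpha(G)$, $\sigma_k(G)=\min\{\Delta(H): H \text{ an induced subgraph of } G \text{ on } \alpha(G)+k \text{ vertices}\}$; for the empty graph, $\sigma_k(\overline{K}_n)=0$ if $k\le 0$ and $\sigma_k(\overline{K}_n)=\infty$ if $1\le k\le n$. Note $\sigma_1(G)=\sigma(G)$. -}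

module Defs where

open import Data.Nat using (ℕ; zero; suc; _+_; _∸_; _⊔_; _⊓_; _≤ᵇ_; _<ᵇ_)
open import Data.Bool using (Bool; true; false; _∧_; _∨_; not; if_then_else_)
open import Data.Fin using (Fin; splitAt)
open import Data.Sum using (_⊎_; inj₁; inj₂)
open import Data.List using (List; []; _∷_; map; _++_; foldr; filter)
open import Data.Vec using (Vec; []; _∷_; lookup; tabulate)
open import Data.Fin.Subset using (Subset; ∣_∣; inside; outside)
open import Relation.Binary.PropositionalEquality using (_≡_; refl)

record Graph (n : ℕ) : Set where
  field
    adj    : Fin n → Fin n → Bool
    sym    : ∀ u v → adj u v ≡ adj v u
    irrefl : ∀ v → adj v v ≡ false
open Graph public

joinAdj : ∀ {n₁ n₂} → Graph n₁ → Graph n₂ → Fin (n₁ + n₂) → Fin (n₁ + n₂) → Bool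
joinAdj {n₁} G₁ G₂ u v with splitAt n₁ u | splitAt n₁ v
... | inj₁ a | inj₁ b = adj G₁ a b
... | inj₂ a | inj₂ b = adj G₂ a b
... | inj₁ _ | inj₂ _ = true
... | inj₂ _ | inj₁ _ = true

joinSym : ∀ {n₁ n₂} (G₁ : Graph n₁) (G₂ : Graph n₂) u v →
          joinAdj G₁ G₂ u v ≡ joinAdj G₁ G₂ v u
joinSym {n₁} G₁ G₂ u v with splitAt n₁ u | splitAt n₁ v
... | inj₁ a | inj₁ b = sym G₁ a b
... | inj₂ a | inj₂ b = sym G₂ a b
... | inj₁ _ | inj₂ _ = refl
... | inj₂ _ | inj₁ _ = refl

joinIrrefl : ∀ {n₁ n₂} (G₁ : Graph n₁) (G₂ : Graph n₂) v → joinAdj G₁ G₂ v v ≡ false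
joinIrrefl {n₁} G₁ G₂ v with splitAt n₁ v
... | inj₁ a = irrefl G₁ a
... | inj₂ a = irrefl G₂ a

_⋁_ : ∀ {n₁ n₂} → Graph n₁ → Graph n₂ → Graph (n₁ + n₂)
G₁ ⋁ G₂ = record { adj = joinAdj G₁ G₂ ; sym = joinSym G₁ G₂ ; irrefl = joinIrrefl G₁ G₂ }

data ℕ∞ : Set where
  fin : ℕ → ℕ∞
  ∞   : ℕ∞

min∞ : ℕ∞ → ℕ∞ → ℕ∞
min∞ (fin a) (fin b) = fin (a ⊓ b)
min∞ (fin a) ∞       = fin a
min∞ ∞       y       = y

max∞ : ℕ∞ → ℕ∞ → ℕ∞
max∞ (fin a) (fin b) = fin (a ⊔ b)
max∞ _       _       = ∞

_+∞_ : ℕ∞ → ℕ∞ → ℕ∞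
fin a +∞ fin b = fin (a + b)
_     +∞ _     = ∞

minList : List ℕ∞ → ℕ∞
minList = foldr min∞ ∞

-- min_{a ≤ j ≤ b} f j   (∞ if the range is empty)
range : ℕ → ℕ → List ℕ
range a zero    = []
range a (suc k) = a ∷ range (suc a) k

minRange : ℕ → ℕ → (ℕ → ℕ∞) → ℕ∞
minRange a b f = minList (map f (range a (suc b ∸ a)))

allSubsets : ∀ n → List (Subset n)
allSubsets zero    = [] ∷ []
allSubsets (suc n) = map (inside ∷_) (allSubsets n) ++ map (outside ∷_) (allSubsets n)

allFins : ∀ n → List (Fin n)
allFins n = Data.Vec.toList (tabulate (λ i → i))

maxList : List ℕ → ℕ
maxList = foldr _⊔_ 0

countL : ∀ {A : Set} → (A → Bool) → List A → ℕ
countL p []       = 0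
countL p (x ∷ xs) = if p x then suc (countL p xs) else countL p xs

degIn : ∀ {n} → Graph n → Subset n → Fin n → ℕ
degIn {n} G S v = countL (λ u → lookup S u ∧ adj G v u) (allFins n)

-- Δ(G[S]) (0 when S = ∅)
maxDegIn : ∀ {n} → Graph n → Subset n → ℕ
maxDegIn {n} G S = maxList (map (λ v → if lookup S v then degIn G S v else 0) (allFins n))

allL : ∀ {A : Set} → (A → Bool) → List A → Bool
allL p = foldr (λ x b → p x ∧ b) true

isIndep : ∀ {n} → Graph n → Subset n → Bool
isIndep {n} G S =
  allL (λ u → allL (λ v → not (lookup S u ∧ lookup S v ∧ adj G u v)) (allFins n)) (allFins n)

α : ∀ {n} → Graph n → ℕ
α {n} G = maxList (map (λ S → if isIndep G S then ∣ S ∣ else 0) (allSubsets n))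

-- sensitivity σ(G) = min { Δ(G[S]) : |S| > α(G) }  (∞ if no such S, i.e. G edgeless)
σ : ∀ {n} → Graph n → ℕ∞
σ {n} G = minList (map (λ S → if α G <ᵇ ∣ S ∣ then fin (maxDegIn G S) else ∞) (allSubsets n))

-- k-sensitivity σ_k(G) = min { Δ(G[S]) : |S| = α(G) + k } for k ≥ 1,
-- taken to be ∞ when no such S exists (k > |V| - α(G)); σ_0 = 0.
σₖ : ∀ {n} → ℕ → Graph n → ℕ∞
σₖ zero    G = fin 0
σₖ {n} (suc k) G =
  minList (map (λ S → if (∣ S ∣ Data.Nat.≡ᵇ (α G + suc k)) then fin (maxDegIn G S) else ∞)
               (allSubsets n))

module Submission where

-- Write a vertex set of G₁ ∨ G₂ as S₁ ++ S₂ with i = |S₁| and j = |S₂|. Every vertex on one side is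
-- adjacent to all of the other side, so α(G₁ ∨ G₂) = α₁ ⊔ α₂ = α₁, and for nonempty S₁, S₂ the
-- maximum degree is (Δ(G₁[S₁]) + j) ⊔ (i + Δ(G₂[S₂])).
-- Lower bound, for i + j > α₁: if i > α₁ then Δ ≥ σ(G₁); if j > α₁ then S₂ contains an
-- (α₁+1)-set, so Δ ≥ σ_{α₁+1−α₂}(G₂); otherwise i ≥ α₁+1−j ≥ 1 and Δ(G₂[S₂]) ≥ σ_{j−α₂}(G₂),
-- so Δ ≥ c_j, which equals b_j when j ≤ α₂.
-- Upper bound: each term is realised by S ++ ∅, by ∅ ++ T, or by an independent (α₁+1−j)-set of
-- G₁ next to a j-set of G₂ realising σ_{j−α₂}(G₂).

open import Defs hiding (sym)
open import Data.Nat
  using (ℕ; zero; suc; _+_; _∸_; _⊔_; _≤_; _<_; _≥_; z≤n; s≤s; z<s; s≤s⁻¹; _≟_; _<ᵇ_; _≡ᵇ_)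
open import Data.Nat.Properties
open import Data.Bool using (Bool; true; false; T; if_then_else_; _∧_; not)
open import Data.Bool.Properties using (T-≡; T-∧; T-not-≡; ∧-identityʳ)
open import Data.Unit using (tt)
open import Data.Sum using (_⊎_; inj₁; inj₂)
import Data.Sum as Sum
open import Data.Product using (_×_; _,_; proj₁; proj₂; ∃-syntax)
open import Data.List using (List; []; _∷_; map)
open import Data.List.Membership.Propositional using () renaming (_∈_ to _∈ₗ_)
open import Data.List.Membership.Propositional.Properties using (∈-map⁺; ∈-map⁻; ∈-++⁺ˡ; ∈-++⁺ʳ)
open import Data.List.Relation.Unary.Any using (here; there)
open import Data.Vec using ([]; _∷_; _++_; here; there; lookup; tabulate; toList)
import Data.Vec as Vec
open import Data.Vec.Properties
  using (lookup∘tabulate; tabulate∘lookup; tabulate-cong; lookup-++ˡ; lookup-++ʳ; []=⇒lookup; lookup⇒[]=)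
open import Data.Fin using (Fin; zero; suc; splitAt; _↑ˡ_; _↑ʳ_)
open import Data.Fin.Properties using (splitAt-↑ˡ; splitAt-↑ʳ; splitAt⁻¹-↑ˡ; splitAt⁻¹-↑ʳ)
open import Data.Vec.Membership.Propositional.Properties using (∈-toList⁺; ∈-allFin⁺)
open import Data.Fin.Subset using (Subset; inside; outside; ∣_∣; _∈_; _⊆_; ⊥; Nonempty; Empty)
open import Data.Fin.Subset.Properties
  using (∉⊥; ⊥⊆; ∣⊥∣≡0; ∣p∣≤n; out⊆; in⊆in; Empty-unique; nonempty?; p⊆q⇒∣p∣≤∣q∣)
open import Function.Bundles using (Equivalence)
open import Relation.Binary.PropositionalEquality
  using (_≡_; refl; sym; trans; cong; cong₂; subst; subst₂; module ≡-Reasoning)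
open import Relation.Nullary using (contradiction; yes; no)

m∸n≡1+o⇒m≡n+1+o : ∀ {m n o} → m ∸ n ≡ suc o → m ≡ n + suc o
m∸n≡1+o⇒m≡n+1+o {m} {n} eq = trans (sym (m+[n∸m]≡n n≤m)) (cong (n +_) eq)
  where
  n≤m : n ≤ m
  n≤m = <⇒≤ (m∸n≢0⇒n<m λ m∸n≡0 → contradiction (trans (sym eq) m∸n≡0) λ ())

0<1+m∸n : ∀ {m n} → n ≤ m → 0 < suc m ∸ n
0<1+m∸n n≤m = subst (0 <_) (sym (+-∸-assoc 1 n≤m)) z<s

m<n+o∧n≤m⇒0<o : ∀ {m n o} → m < n + o → n ≤ m → 0 < o
m<n+o∧n≤m⇒0<o {m} {n} m<n+o n≤m = ≤-trans (0<1+m∸n n≤m) (m≤n+o⇒m∸n≤o (suc m) n m<n+o)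

m≡0⊎n≡0⇒m+n≡m⊔n : ∀ {m n} → m ≡ 0 ⊎ n ≡ 0 → m + n ≡ m ⊔ n
m≡0⊎n≡0⇒m+n≡m⊔n         (inj₁ refl) = refl
m≡0⊎n≡0⇒m+n≡m⊔n {m = m} (inj₂ refl) = trans (+-identityʳ m) (sym (⊔-identityʳ m))

infix 4 _≤∞_

data _≤∞_ : ℕ∞ → ℕ∞ → Set where
  fin≤fin : ∀ {m n} → m ≤ n → fin m ≤∞ fin n
  ≤∞-top  : ∀ {x} → x ≤∞ ∞

≤∞-refl : ∀ {x} → x ≤∞ x
≤∞-refl {fin m} = fin≤fin ≤-refl
≤∞-refl {∞}     = ≤∞-top

≤∞-reflexive : ∀ {x y} → x ≡ y → x ≤∞ y
≤∞-reflexive refl = ≤∞-refl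

≤∞-trans : ∀ {x y z} → x ≤∞ y → y ≤∞ z → x ≤∞ z
≤∞-trans (fin≤fin p) (fin≤fin q) = fin≤fin (≤-trans p q)
≤∞-trans _           ≤∞-top      = ≤∞-top

≤∞-antisym : ∀ {x y} → x ≤∞ y → y ≤∞ x → x ≡ y
≤∞-antisym (fin≤fin p) (fin≤fin q) = cong fin (≤-antisym p q)
≤∞-antisym ≤∞-top      ≤∞-top      = refl

min∞-≤ˡ : ∀ x y → min∞ x y ≤∞ x
min∞-≤ˡ (fin m) (fin n) = fin≤fin (m⊓n≤m m n)
min∞-≤ˡ (fin m) ∞       = ≤∞-refl
min∞-≤ˡ ∞       y       = ≤∞-top

min∞-≤ʳ : ∀ x y → min∞ x y ≤∞ y
min∞-≤ʳ (fin m) (fin n) = fin≤fin (m⊓n≤n m n)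
min∞-≤ʳ (fin m) ∞       = ≤∞-top
min∞-≤ʳ ∞       y       = ≤∞-refl

min∞-glb : ∀ {z x y} → z ≤∞ x → z ≤∞ y → z ≤∞ min∞ x y
min∞-glb (fin≤fin p) (fin≤fin q) = fin≤fin (⊓-glb p q)
min∞-glb (fin≤fin p) ≤∞-top      = fin≤fin p
min∞-glb ≤∞-top      q           = q

min∞-monoʳ : ∀ x {y z} → y ≤∞ z → min∞ x y ≤∞ min∞ x z
min∞-monoʳ x {y} y≤z = min∞-glb (min∞-≤ˡ x y) (≤∞-trans (min∞-≤ʳ x y) y≤z)

min∞-sel : ∀ x y → min∞ x y ≡ x ⊎ min∞ x y ≡ y
min∞-sel (fin m) (fin n) with ⊓-sel m n
... | inj₁ eq = inj₁ (cong fin eq)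
... | inj₂ eq = inj₂ (cong fin eq)
min∞-sel (fin m) ∞       = inj₁ refl
min∞-sel ∞       y       = inj₂ refl

+∞-monoʳ : ∀ z {x y} → x ≤∞ y → z +∞ x ≤∞ z +∞ y
+∞-monoʳ (fin k) (fin≤fin m≤n) = fin≤fin (+-monoʳ-≤ k m≤n)
+∞-monoʳ (fin k) ≤∞-top        = ≤∞-top
+∞-monoʳ ∞       _             = ≤∞-top

max∞-monoʳ : ∀ z {x y} → x ≤∞ y → max∞ z x ≤∞ max∞ z y
max∞-monoʳ (fin k) (fin≤fin m≤n) = fin≤fin (⊔-monoʳ-≤ k m≤n)
max∞-monoʳ (fin k) ≤∞-top        = ≤∞-top
max∞-monoʳ ∞       _             = ≤∞-top

minList-≤ : ∀ {x xs} → x ∈ₗ xs → minList xs ≤∞ x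
minList-≤ {xs = y ∷ ys} (here refl) = min∞-≤ˡ y (minList ys)
minList-≤ {xs = y ∷ ys} (there x∈) = ≤∞-trans (min∞-≤ʳ y (minList ys)) (minList-≤ x∈)

minList-glb : ∀ {z} xs → (∀ {x} → x ∈ₗ xs → z ≤∞ x) → z ≤∞ minList xs
minList-glb []       _   = ≤∞-top
minList-glb (x ∷ xs) z≤ = min∞-glb (z≤ (here refl)) (minList-glb xs (λ x∈ → z≤ (there x∈)))

minList-sel : ∀ xs → minList xs ≡ ∞ ⊎ minList xs ∈ₗ xs
minList-sel []       = inj₁ refl
minList-sel (x ∷ xs) with min∞-sel x (minList xs)
... | inj₁ eq = inj₂ (here eq)
... | inj₂ eq with minList-sel xs
...   | inj₁ eq′ = inj₁ (trans eq eq′)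
...   | inj₂ x∈  = inj₂ (there (subst (_∈ₗ xs) (sym eq) x∈))

maxList-≥ : ∀ {x xs} → x ∈ₗ xs → x ≤ maxList xs
maxList-≥ {xs = y ∷ ys} (here refl) = m≤m⊔n y (maxList ys)
maxList-≥ {xs = y ∷ ys} (there x∈) = ≤-trans (maxList-≥ x∈) (m≤n⊔m y (maxList ys))

maxList-lub : ∀ {m} xs → (∀ {x} → x ∈ₗ xs → x ≤ m) → maxList xs ≤ m
maxList-lub []       _   = z≤n
maxList-lub (x ∷ xs) ≤m = ⊔-lub (≤m (here refl)) (maxList-lub xs (λ x∈ → ≤m (there x∈)))

maxList-sel : ∀ xs → maxList xs ≡ 0 ⊎ maxList xs ∈ₗ xs
maxList-sel []       = inj₁ refl
maxList-sel (x ∷ xs) with ⊔-sel x (maxList xs)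
... | inj₁ eq = inj₂ (here eq)
... | inj₂ eq with maxList-sel xs
...   | inj₁ eq′ = inj₁ (trans eq eq′)
...   | inj₂ x∈  = inj₂ (there (subst (_∈ₗ xs) (sym eq) x∈))

module _ {A : Set} (p : A → Bool) (f : A → ℕ) where

  minWhere : List A → ℕ∞
  minWhere xs = minList (map (λ y → if p y then fin (f y) else ∞) xs)

  maxWhere : List A → ℕ
  maxWhere xs = maxList (map (λ y → if p y then f y else 0) xs)

  minWhere-≤ : ∀ {x xs} → x ∈ₗ xs → T (p x) → minWhere xs ≤∞ fin (f x)
  minWhere-≤ {x} x∈ px with p x | ∈-map⁺ (λ y → if p y then fin (f y) else ∞) x∈
  ... | true | fx∈ = minList-≤ fx∈

  minWhere-glb : ∀ {z} xs → (∀ x → T (p x) → z ≤∞ fin (f x)) → z ≤∞ minWhere xs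
  minWhere-glb {z} xs bound = minList-glb _ λ y∈ → value (∈-map⁻ _ y∈)
    where
    value : ∀ {y} → ∃[ x ] x ∈ₗ xs × y ≡ (if p x then fin (f x) else ∞) → z ≤∞ y
    value (x , _ , refl) with p x in px
    ... | true  = bound x (subst T (sym px) tt)
    ... | false = ≤∞-top

  minWhere-attained : ∀ xs {k} → minWhere xs ≡ fin k → ∃[ x ] T (p x) × f x ≡ k
  minWhere-attained xs min≡k with minList-sel (map (λ y → if p y then fin (f y) else ∞) xs)
  ... | inj₁ min≡∞ = contradiction (trans (sym min≡∞) min≡k) λ ()
  ... | inj₂ min∈ with ∈-map⁻ _ min∈
  ...   | x , _ , min≡ with p x in px | trans (sym min≡) min≡k
  ...     | true | refl = x , subst T (sym px) tt , refl

  maxWhere-≥ : ∀ {x xs} → x ∈ₗ xs → T (p x) → f x ≤ maxWhere xs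
  maxWhere-≥ {x} x∈ px with p x | ∈-map⁺ (λ y → if p y then f y else 0) x∈
  ... | true | fx∈ = maxList-≥ fx∈

  maxWhere-lub : ∀ {m} xs → (∀ x → T (p x) → f x ≤ m) → maxWhere xs ≤ m
  maxWhere-lub {m} xs bound = maxList-lub _ λ y∈ → value (∈-map⁻ _ y∈)
    where
    value : ∀ {y} → ∃[ x ] x ∈ₗ xs × y ≡ (if p x then f x else 0) → y ≤ m
    value (x , _ , refl) with p x in px
    ... | true  = bound x (subst T (sym px) tt)
    ... | false = z≤n

  maxWhere-attained : ∀ xs → maxWhere xs ≡ 0 ⊎ ∃[ x ] T (p x) × maxWhere xs ≡ f x
  maxWhere-attained xs with maxList-sel (map (λ y → if p y then f y else 0) xs)
  ... | inj₁ max≡0 = inj₁ max≡0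
  ... | inj₂ max∈ with ∈-map⁻ _ max∈
  ...   | x , _ , max≡ with p x in px
  ...     | true  = inj₂ (x , subst T (sym px) tt , max≡)
  ...     | false = inj₁ max≡

∈-allSubsets : ∀ {n} (S : Subset n) → S ∈ₗ allSubsets n
∈-allSubsets []            = here refl
∈-allSubsets (inside ∷ S)  = ∈-++⁺ˡ (∈-map⁺ (inside ∷_) (∈-allSubsets S))
∈-allSubsets (outside ∷ S) = ∈-++⁺ʳ _ (∈-map⁺ (outside ∷_) (∈-allSubsets S))

∈-allFins : ∀ {n} (i : Fin n) → i ∈ₗ allFins n
∈-allFins i = ∈-toList⁺ (∈-allFin⁺ i)

∈-range⁺ : ∀ {a k j} → a ≤ j → j < a + k → j ∈ₗ range a k
∈-range⁺ {a} {zero}  a≤j j<a+0 =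
  contradiction (≤-trans j<a+0 (≤-reflexive (+-identityʳ a))) (≤⇒≯ a≤j)
∈-range⁺ {a} {suc k} {j} a≤j j<a+k with a ≟ j
... | yes refl = here refl
... | no a≢j   = there (∈-range⁺ (≤∧≢⇒< a≤j a≢j) (≤-trans j<a+k (≤-reflexive (+-suc a k))))

∈-range⁻ : ∀ {a k j} → j ∈ₗ range a k → a ≤ j × j < a + k
∈-range⁻ {a} {suc k} (here refl) = ≤-refl , m<m+n a z<s
∈-range⁻ {a} {suc k} (there j∈) with ∈-range⁻ j∈
... | a<j , j<a+k = <⇒≤ a<j , ≤-trans j<a+k (≤-reflexive (sym (+-suc a k)))

minRange-≤ : ∀ {a b j} (f : ℕ → ℕ∞) → a ≤ j → j ≤ b → minRange a b f ≤∞ f j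
minRange-≤ {a} {b} {j} f a≤j j≤b =
  minList-≤ (∈-map⁺ f (∈-range⁺ a≤j (subst (j <_) (sym (m+[n∸m]≡n a≤1+b)) (s≤s j≤b))))
  where
  a≤1+b : a ≤ suc b
  a≤1+b = m≤n⇒m≤1+n (≤-trans a≤j j≤b)

minRange-glb : ∀ {z} a b (f : ℕ → ℕ∞) → (∀ j → a ≤ j → j ≤ b → z ≤∞ f j) → z ≤∞ minRange a b f
minRange-glb {z} a b f bound = minList-glb _ λ y∈ → case (∈-map⁻ f y∈)
  where
  ≤b : ∀ {j} → a ≤ j → j < a + (suc b ∸ a) → j ≤ b
  ≤b {j} a≤j j< with ≤-total a (suc b)
  ... | inj₁ a≤1+b = s≤s⁻¹ (subst (j <_) (m+[n∸m]≡n a≤1+b) j<)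
  ... | inj₂ 1+b≤a =
    contradiction (subst (j <_) (trans (cong (a +_) (m≤n⇒m∸n≡0 1+b≤a)) (+-identityʳ a)) j<) (≤⇒≯ a≤j)

  case : ∀ {y} → ∃[ j ] j ∈ₗ range a (suc b ∸ a) × y ≡ f j → z ≤∞ y
  case (j , j∈ , refl) with ∈-range⁻ j∈
  ... | a≤j , j< = bound j a≤j (≤b a≤j j<)

⊆-ofSize : ∀ {n} (S : Subset n) {k} → k ≤ ∣ S ∣ → ∃[ R ] R ⊆ S × ∣ R ∣ ≡ k
⊆-ofSize {n} S        {zero}  _        = ⊥ , ⊥⊆ , ∣⊥∣≡0 n
⊆-ofSize (outside ∷ S) {suc k} k<∣S∣    with ⊆-ofSize S k<∣S∣
... | R , R⊆S , ∣R∣≡k = outside ∷ R , out⊆ R⊆S , ∣R∣≡k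
⊆-ofSize (inside ∷ S)  {suc k} (s≤s k≤) with ⊆-ofSize S k≤
... | R , R⊆S , ∣R∣≡k = inside ∷ R , in⊆in R⊆S , cong suc ∣R∣≡k

∣p++q∣≡∣p∣+∣q∣ : ∀ {m n} (p : Subset m) (q : Subset n) → ∣ p ++ q ∣ ≡ ∣ p ∣ + ∣ q ∣
∣p++q∣≡∣p∣+∣q∣ []            q = refl
∣p++q∣≡∣p∣+∣q∣ (inside ∷ p)  q = cong suc (∣p++q∣≡∣p∣+∣q∣ p q)
∣p++q∣≡∣p∣+∣q∣ (outside ∷ p) q = ∣p++q∣≡∣p∣+∣q∣ p q

∣p++⊥∣≡∣p∣ : ∀ {m n} (p : Subset m) → ∣ p ++ ⊥ {n} ∣ ≡ ∣ p ∣
∣p++⊥∣≡∣p∣ {n = n} p =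
  trans (∣p++q∣≡∣p∣+∣q∣ p (⊥ {n})) (trans (cong (∣ p ∣ +_) (∣⊥∣≡0 n)) (+-identityʳ _))

∣⊥++q∣≡∣q∣ : ∀ {m n} (q : Subset n) → ∣ ⊥ {m} ++ q ∣ ≡ ∣ q ∣
∣⊥++q∣≡∣q∣ {m} q = trans (∣p++q∣≡∣p∣+∣q∣ (⊥ {m}) q) (cong (_+ ∣ q ∣) (∣⊥∣≡0 m))

module _ {m n} (p : Subset m) (q : Subset n) where

  ∈-++-↑ˡ⁺ : ∀ {x} → x ∈ p → x ↑ˡ n ∈ p ++ q
  ∈-++-↑ˡ⁺ {x} x∈p = lookup⇒[]= _ _ (trans (lookup-++ˡ p q x) ([]=⇒lookup x∈p))

  ∈-++-↑ˡ⁻ : ∀ {x} → x ↑ˡ n ∈ p ++ q → x ∈ p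
  ∈-++-↑ˡ⁻ {x} x∈ = lookup⇒[]= _ _ (trans (sym (lookup-++ˡ p q x)) ([]=⇒lookup x∈))

  ∈-++-↑ʳ⁺ : ∀ {y} → y ∈ q → m ↑ʳ y ∈ p ++ q
  ∈-++-↑ʳ⁺ {y} y∈q = lookup⇒[]= _ _ (trans (lookup-++ʳ p q y) ([]=⇒lookup y∈q))

  ∈-++-↑ʳ⁻ : ∀ {y} → m ↑ʳ y ∈ p ++ q → y ∈ q
  ∈-++-↑ʳ⁻ {y} y∈ = lookup⇒[]= _ _ (trans (sym (lookup-++ʳ p q y)) ([]=⇒lookup y∈))

0<∣p∣⇒Nonempty : ∀ {n} {p : Subset n} → 0 < ∣ p ∣ → Nonempty p
0<∣p∣⇒Nonempty {p = inside ∷ p}  _       = zero , here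
0<∣p∣⇒Nonempty {p = outside ∷ p} 0<∣p∣ with 0<∣p∣⇒Nonempty 0<∣p∣
... | x , x∈p = suc x , there x∈p

Empty⇒∣p∣≡0 : ∀ {n} {p : Subset n} → Empty p → ∣ p ∣ ≡ 0
Empty⇒∣p∣≡0 {n} empty = trans (cong ∣_∣ (Empty-unique empty)) (∣⊥∣≡0 n)

∈⇒T-lookup : ∀ {n} {S : Subset n} {x} → x ∈ S → T (lookup S x)
∈⇒T-lookup x∈S = Equivalence.from T-≡ ([]=⇒lookup x∈S)

T-lookup⇒∈ : ∀ {n} {S : Subset n} {x} → T (lookup S x) → x ∈ S
T-lookup⇒∈ {S = S} {x} t = lookup⇒[]= x S (Equivalence.to T-≡ t)

∈-tabulate⁺ : ∀ {n} {p : Fin n → Bool} {x} → p x ≡ true → x ∈ tabulate p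
∈-tabulate⁺ {p = p} {x} px = lookup⇒[]= x (tabulate p) (trans (lookup∘tabulate p x) px)

∈-tabulate⁻ : ∀ {n} {p : Fin n → Bool} {x} → x ∈ tabulate p → p x ≡ true
∈-tabulate⁻ {p = p} {x} x∈ = trans (sym (lookup∘tabulate p x)) ([]=⇒lookup x∈)

tabulate-↑ˡ-↑ʳ : ∀ {A : Set} m {n} (f : Fin (m + n) → A) →
                 tabulate f ≡ tabulate (λ i → f (i ↑ˡ n)) ++ tabulate (λ j → f (m ↑ʳ j))
tabulate-↑ˡ-↑ʳ zero    f = refl
tabulate-↑ˡ-↑ʳ (suc m) f = cong (f zero ∷_) (tabulate-↑ˡ-↑ʳ m (λ i → f (suc i)))

↑-view : ∀ {m n} (v : Fin (m + n)) → (∃[ x ] x ↑ˡ n ≡ v) ⊎ (∃[ y ] m ↑ʳ y ≡ v)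
↑-view {m} v with splitAt m v in eq
... | inj₁ x = inj₁ (x , splitAt⁻¹-↑ˡ eq)
... | inj₂ y = inj₂ (y , splitAt⁻¹-↑ʳ eq)

countL-tabulate : ∀ {A : Set} {n} (p : A → Bool) (f : Fin n → A) →
                  countL p (toList (tabulate f)) ≡ ∣ tabulate (λ i → p (f i)) ∣
countL-tabulate {n = zero}  p f = refl
countL-tabulate {n = suc n} p f with p (f zero)
... | true  = cong suc (countL-tabulate p (λ i → f (suc i)))
... | false = countL-tabulate p (λ i → f (suc i))

allL-sound : ∀ {A : Set} (p : A → Bool) {x xs} → T (allL p xs) → x ∈ₗ xs → T (p x)
allL-sound p {xs = y ∷ ys} t (here refl) = proj₁ (Equivalence.to T-∧ t)
allL-sound p {xs = y ∷ ys} t (there x∈) = allL-sound p (proj₂ (Equivalence.to T-∧ t)) x∈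

allL-complete : ∀ {A : Set} (p : A → Bool) xs → (∀ x → T (p x)) → T (allL p xs)
allL-complete p []       _   = tt
allL-complete p (x ∷ xs) all = Equivalence.from T-∧ (all x , allL-complete p xs all)

Independent : ∀ {n} → Graph n → Subset n → Set
Independent G S = ∀ {u v} → u ∈ S → v ∈ S → adj G u v ≡ false

⊆-Independent : ∀ {n} (G : Graph n) {R S} → R ⊆ S → Independent G S → Independent G R
⊆-Independent G R⊆S I u∈ v∈ = I (R⊆S u∈) (R⊆S v∈)

⊥-Independent : ∀ {n} (G : Graph n) → Independent G ⊥
⊥-Independent G u∈ _ = contradiction u∈ ∉⊥

private
  notEdgeIn : ∀ {n} → Graph n → Subset n → Fin n → Fin n → Bool
  notEdgeIn G S u v = not (lookup S u ∧ lookup S v ∧ adj G u v)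

isIndep⇒Independent : ∀ {n} (G : Graph n) {S} → T (isIndep G S) → Independent G S
isIndep⇒Independent {n} G {S} t {u} {v} u∈ v∈ =
  reflect ([]=⇒lookup u∈) ([]=⇒lookup v∈)
    (allL-sound (notEdgeIn G S u)
                (allL-sound (λ u → allL (notEdgeIn G S u) (allFins n)) t (∈-allFins u))
                (∈-allFins v))
  where
  reflect : ∀ {a b c} → a ≡ true → b ≡ true → T (not (a ∧ b ∧ c)) → c ≡ false
  reflect refl refl = Equivalence.to T-not-≡

Independent⇒isIndep : ∀ {n} (G : Graph n) {S} → Independent G S → T (isIndep G S)
Independent⇒isIndep {n} G {S} I =
  allL-complete (λ u → allL (notEdgeIn G S u) (allFins n)) (allFins n) λ u →
  allL-complete (notEdgeIn G S u) (allFins n) (noEdge u)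
  where
  noEdge : ∀ u v → T (notEdgeIn G S u v)
  noEdge u v with lookup S u in su | lookup S v in sv
  ... | false | _     = tt
  ... | true  | false = tt
  ... | true  | true  = Equivalence.from T-not-≡ (I (lookup⇒[]= u S su) (lookup⇒[]= v S sv))

α-≥ : ∀ {n} (G : Graph n) {S : Subset n} → Independent G S → ∣ S ∣ ≤ α G
α-≥ G {S} I = maxWhere-≥ (isIndep G) ∣_∣ (∈-allSubsets S) (Independent⇒isIndep G I)

α-attained : ∀ {n} (G : Graph n) → ∃[ S ] Independent G S × ∣ S ∣ ≡ α G
α-attained {n} G with maxWhere-attained (isIndep G) ∣_∣ (allSubsets n)
... | inj₁ α≡0            = ⊥ , ⊥-Independent G , trans (∣⊥∣≡0 n) (sym α≡0)
... | inj₂ (S , indep , α≡) = S , isIndep⇒Independent G indep , sym α≡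

Independent-ofSize : ∀ {n} (G : Graph n) {k} → k ≤ α G → ∃[ S ] Independent G S × ∣ S ∣ ≡ k
Independent-ofSize G k≤α with α-attained G
... | I , indep , ∣I∣≡α with ⊆-ofSize I (≤-trans k≤α (≤-reflexive (sym ∣I∣≡α)))
...   | S , S⊆I , ∣S∣≡k = S , ⊆-Independent G S⊆I indep , ∣S∣≡k

neighboursIn : ∀ {n} → Graph n → Subset n → Fin n → Subset n
neighboursIn G S v = tabulate (λ u → lookup S u ∧ adj G v u)

degIn≡∣neighboursIn∣ : ∀ {n} (G : Graph n) S v → degIn G S v ≡ ∣ neighboursIn G S v ∣
degIn≡∣neighboursIn∣ G S v = countL-tabulate (λ u → lookup S u ∧ adj G v u) (λ u → u)

∈-neighboursIn⁺ : ∀ {n} (G : Graph n) {S v u} → u ∈ S → adj G v u ≡ true → u ∈ neighboursIn G S v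
∈-neighboursIn⁺ G {S} u∈S uv = ∈-tabulate⁺ (subst (λ b → b ∧ _ ≡ true) (sym ([]=⇒lookup u∈S)) uv)

∈-neighboursIn⁻ : ∀ {n} (G : Graph n) {S v u} → u ∈ neighboursIn G S v → u ∈ S × adj G v u ≡ true
∈-neighboursIn⁻ G {S} {u = u} u∈N with lookup S u in su | ∈-tabulate⁻ u∈N
... | true | uv = lookup⇒[]= u S su , uv

degIn-mono : ∀ {n} (G : Graph n) {R S} v → R ⊆ S → degIn G R v ≤ degIn G S v
degIn-mono G {R} {S} v R⊆S =
  subst₂ _≤_ (sym (degIn≡∣neighboursIn∣ G R v)) (sym (degIn≡∣neighboursIn∣ G S v))
    (p⊆q⇒∣p∣≤∣q∣ λ u∈ → let u∈R , uv = ∈-neighboursIn⁻ G u∈ in ∈-neighboursIn⁺ G (R⊆S u∈R) uv)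

degIn-Independent : ∀ {n} (G : Graph n) {S v} → Independent G S → v ∈ S → degIn G S v ≡ 0
degIn-Independent G {S} {v} indep v∈S =
  trans (degIn≡∣neighboursIn∣ G S v) (Empty⇒∣p∣≡0 λ (u , u∈N) →
    let u∈S , uv = ∈-neighboursIn⁻ G u∈N in contradiction (trans (sym uv) (indep v∈S u∈S)) λ ())

maxDegIn-≥ : ∀ {n} (G : Graph n) {S v} → v ∈ S → degIn G S v ≤ maxDegIn G S
maxDegIn-≥ G {S} v∈S = maxWhere-≥ (lookup S) (degIn G S) (∈-allFins _) (∈⇒T-lookup v∈S)

maxDegIn-lub : ∀ {n} (G : Graph n) {S m} → (∀ {v} → v ∈ S → degIn G S v ≤ m) → maxDegIn G S ≤ m
maxDegIn-lub {n} G {S} bound =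
  maxWhere-lub (lookup S) (degIn G S) (allFins n) λ _ t → bound (T-lookup⇒∈ t)

maxDegIn-attained : ∀ {n} (G : Graph n) {S} → Nonempty S → ∃[ v ] v ∈ S × maxDegIn G S ≡ degIn G S v
maxDegIn-attained {n} G {S} (v , v∈S) with maxWhere-attained (lookup S) (degIn G S) (allFins n)
... | inj₂ (u , t , Δ≡) = u , T-lookup⇒∈ t , Δ≡
... | inj₁ Δ≡0          =
  v , v∈S , trans Δ≡0 (sym (n≤0⇒n≡0 (subst (degIn G S v ≤_) Δ≡0 (maxDegIn-≥ G v∈S))))

maxDegIn-mono : ∀ {n} (G : Graph n) {R S} → R ⊆ S → maxDegIn G R ≤ maxDegIn G S
maxDegIn-mono G R⊆S =
  maxDegIn-lub G λ {v} v∈R → ≤-trans (degIn-mono G v R⊆S) (maxDegIn-≥ G (R⊆S v∈R))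

maxDegIn-Independent : ∀ {n} (G : Graph n) {S} → Independent G S → maxDegIn G S ≡ 0
maxDegIn-Independent G indep =
  n≤0⇒n≡0 (maxDegIn-lub G λ v∈S → ≤-reflexive (degIn-Independent G indep v∈S))

σ-≤ : ∀ {n} (G : Graph n) S → α G < ∣ S ∣ → σ G ≤∞ fin (maxDegIn G S)
σ-≤ G S α<∣S∣ = minWhere-≤ (λ R → α G <ᵇ ∣ R ∣) (maxDegIn G) (∈-allSubsets S) (<⇒<ᵇ α<∣S∣)

σ-glb : ∀ {n} (G : Graph n) {z} → (∀ S → α G < ∣ S ∣ → z ≤∞ fin (maxDegIn G S)) → z ≤∞ σ G
σ-glb {n} G bound = minWhere-glb (λ R → α G <ᵇ ∣ R ∣) (maxDegIn G) (allSubsets n)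
                      λ S t → bound S (<ᵇ⇒< (α G) ∣ S ∣ t)

σₖ-≤ : ∀ {n} (G : Graph n) {d} S → ∣ S ∣ ≡ α G + suc d → σₖ (suc d) G ≤∞ fin (maxDegIn G S)
σₖ-≤ G {d} S ∣S∣≡ = minWhere-≤ (λ R → ∣ R ∣ ≡ᵇ α G + suc d) (maxDegIn G) (∈-allSubsets S)
                        (≡⇒≡ᵇ ∣ S ∣ (α G + suc d) ∣S∣≡)

σₖ-attained : ∀ {n} (G : Graph n) {d m} → σₖ (suc d) G ≡ fin m →
              ∃[ S ] ∣ S ∣ ≡ α G + suc d × maxDegIn G S ≡ m
σₖ-attained {n} G {d} σₖ≡m
  with minWhere-attained (λ R → ∣ R ∣ ≡ᵇ α G + suc d) (maxDegIn G) (allSubsets n) σₖ≡m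
... | S , t , Δ≡m = S , ≡ᵇ⇒≡ ∣ S ∣ (α G + suc d) t , Δ≡m

σₖ-∸α-≤ : ∀ {n} (G : Graph n) S → σₖ (∣ S ∣ ∸ α G) G ≤∞ fin (maxDegIn G S)
σₖ-∸α-≤ G S with ∣ S ∣ ∸ α G in eq
... | zero  = fin≤fin z≤n
... | suc d = σₖ-≤ G S (m∸n≡1+o⇒m≡n+1+o eq)

-- For j ≤ α G the index truncates to 0, and σ₀ = 0 is realised by an independent j-set.
σₖ-∸α-attained : ∀ {n} (G : Graph n) j {m} → σₖ (j ∸ α G) G ≡ fin m →
                 ∃[ S ] ∣ S ∣ ≡ j × maxDegIn G S ≡ m
σₖ-∸α-attained G j σₖ≡m with j ∸ α G in eq | σₖ≡m
... | zero  | refl with Independent-ofSize G (m∸n≡0⇒m≤n eq)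
...   | S , indep , ∣S∣≡j = S , ∣S∣≡j , maxDegIn-Independent G indep
σₖ-∸α-attained G j _ | suc d | σₖ≡m with σₖ-attained G σₖ≡m
...   | S , ∣S∣≡ , Δ≡m = S , trans ∣S∣≡ (sym (m∸n≡1+o⇒m≡n+1+o eq)) , Δ≡m

module Join {n₁ n₂} (G₁ : Graph n₁) (G₂ : Graph n₂) where

  adj-⋁-↑ˡ↑ˡ : ∀ x y → adj (G₁ ⋁ G₂) (x ↑ˡ n₂) (y ↑ˡ n₂) ≡ adj G₁ x y
  adj-⋁-↑ˡ↑ˡ x y rewrite splitAt-↑ˡ n₁ x n₂ | splitAt-↑ˡ n₁ y n₂ = refl

  adj-⋁-↑ˡ↑ʳ : ∀ x y → adj (G₁ ⋁ G₂) (x ↑ˡ n₂) (n₁ ↑ʳ y) ≡ true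
  adj-⋁-↑ˡ↑ʳ x y rewrite splitAt-↑ˡ n₁ x n₂ | splitAt-↑ʳ n₁ n₂ y = refl

  adj-⋁-↑ʳ↑ˡ : ∀ y x → adj (G₁ ⋁ G₂) (n₁ ↑ʳ y) (x ↑ˡ n₂) ≡ true
  adj-⋁-↑ʳ↑ˡ y x rewrite splitAt-↑ʳ n₁ n₂ y | splitAt-↑ˡ n₁ x n₂ = refl

  adj-⋁-↑ʳ↑ʳ : ∀ x y → adj (G₁ ⋁ G₂) (n₁ ↑ʳ x) (n₁ ↑ʳ y) ≡ adj G₂ x y
  adj-⋁-↑ʳ↑ʳ x y rewrite splitAt-↑ʳ n₁ n₂ x | splitAt-↑ʳ n₁ n₂ y = refl

  module _ (S₁ : Subset n₁) (S₂ : Subset n₂) where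

    neighboursIn-⋁-↑ˡ : ∀ x →
      neighboursIn (G₁ ⋁ G₂) (S₁ ++ S₂) (x ↑ˡ n₂) ≡ neighboursIn G₁ S₁ x ++ S₂
    neighboursIn-⋁-↑ˡ x = trans (tabulate-↑ˡ-↑ʳ n₁ _) (cong₂ _++_
      (tabulate-cong λ a → cong₂ _∧_ (lookup-++ˡ S₁ S₂ a) (adj-⋁-↑ˡ↑ˡ x a))
      (trans (tabulate-cong λ b →
                trans (cong₂ _∧_ (lookup-++ʳ S₁ S₂ b) (adj-⋁-↑ˡ↑ʳ x b)) (∧-identityʳ _))
             (tabulate∘lookup S₂)))

    neighboursIn-⋁-↑ʳ : ∀ y →
      neighboursIn (G₁ ⋁ G₂) (S₁ ++ S₂) (n₁ ↑ʳ y) ≡ S₁ ++ neighboursIn G₂ S₂ y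
    neighboursIn-⋁-↑ʳ y = trans (tabulate-↑ˡ-↑ʳ n₁ _) (cong₂ _++_
      (trans (tabulate-cong λ a →
                trans (cong₂ _∧_ (lookup-++ˡ S₁ S₂ a) (adj-⋁-↑ʳ↑ˡ y a)) (∧-identityʳ _))
             (tabulate∘lookup S₁))
      (tabulate-cong λ b → cong₂ _∧_ (lookup-++ʳ S₁ S₂ b) (adj-⋁-↑ʳ↑ʳ y b)))

    degIn-⋁-↑ˡ : ∀ x → degIn (G₁ ⋁ G₂) (S₁ ++ S₂) (x ↑ˡ n₂) ≡ degIn G₁ S₁ x + ∣ S₂ ∣
    degIn-⋁-↑ˡ x = begin
      degIn (G₁ ⋁ G₂) (S₁ ++ S₂) (x ↑ˡ n₂)
        ≡⟨ degIn≡∣neighboursIn∣ (G₁ ⋁ G₂) (S₁ ++ S₂) (x ↑ˡ n₂) ⟩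
      ∣ neighboursIn (G₁ ⋁ G₂) (S₁ ++ S₂) (x ↑ˡ n₂) ∣
        ≡⟨ cong ∣_∣ (neighboursIn-⋁-↑ˡ x) ⟩
      ∣ neighboursIn G₁ S₁ x ++ S₂ ∣
        ≡⟨ ∣p++q∣≡∣p∣+∣q∣ (neighboursIn G₁ S₁ x) S₂ ⟩
      ∣ neighboursIn G₁ S₁ x ∣ + ∣ S₂ ∣
        ≡⟨ cong (_+ ∣ S₂ ∣) (degIn≡∣neighboursIn∣ G₁ S₁ x) ⟨
      degIn G₁ S₁ x + ∣ S₂ ∣
        ∎
      where open ≡-Reasoning

    degIn-⋁-↑ʳ : ∀ y → degIn (G₁ ⋁ G₂) (S₁ ++ S₂) (n₁ ↑ʳ y) ≡ ∣ S₁ ∣ + degIn G₂ S₂ y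
    degIn-⋁-↑ʳ y = begin
      degIn (G₁ ⋁ G₂) (S₁ ++ S₂) (n₁ ↑ʳ y)
        ≡⟨ degIn≡∣neighboursIn∣ (G₁ ⋁ G₂) (S₁ ++ S₂) (n₁ ↑ʳ y) ⟩
      ∣ neighboursIn (G₁ ⋁ G₂) (S₁ ++ S₂) (n₁ ↑ʳ y) ∣
        ≡⟨ cong ∣_∣ (neighboursIn-⋁-↑ʳ y) ⟩
      ∣ S₁ ++ neighboursIn G₂ S₂ y ∣
        ≡⟨ ∣p++q∣≡∣p∣+∣q∣ S₁ (neighboursIn G₂ S₂ y) ⟩
      ∣ S₁ ∣ + ∣ neighboursIn G₂ S₂ y ∣
        ≡⟨ cong (∣ S₁ ∣ +_) (degIn≡∣neighboursIn∣ G₂ S₂ y) ⟨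
      ∣ S₁ ∣ + degIn G₂ S₂ y
        ∎
      where open ≡-Reasoning

    maxDegIn-⋁-lub : ∀ {m} → (∀ {x} → x ∈ S₁ → degIn G₁ S₁ x + ∣ S₂ ∣ ≤ m) →
                     (∀ {y} → y ∈ S₂ → ∣ S₁ ∣ + degIn G₂ S₂ y ≤ m) →
                     maxDegIn (G₁ ⋁ G₂) (S₁ ++ S₂) ≤ m
    maxDegIn-⋁-lub {m} boundˡ boundʳ = maxDegIn-lub (G₁ ⋁ G₂) bound
      where
      bound : ∀ {v} → v ∈ S₁ ++ S₂ → degIn (G₁ ⋁ G₂) (S₁ ++ S₂) v ≤ m
      bound {v} v∈ with ↑-view {n₁} {n₂} v
      ... | inj₁ (x , refl) = subst (_≤ m) (sym (degIn-⋁-↑ˡ x)) (boundˡ (∈-++-↑ˡ⁻ S₁ S₂ v∈))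
      ... | inj₂ (y , refl) = subst (_≤ m) (sym (degIn-⋁-↑ʳ y)) (boundʳ (∈-++-↑ʳ⁻ S₁ S₂ v∈))

    degIn-⋁-↑ˡ-≤ : ∀ {x} → x ∈ S₁ → degIn G₁ S₁ x + ∣ S₂ ∣ ≤ maxDegIn (G₁ ⋁ G₂) (S₁ ++ S₂)
    degIn-⋁-↑ˡ-≤ {x} x∈ = subst (_≤ maxDegIn (G₁ ⋁ G₂) (S₁ ++ S₂)) (degIn-⋁-↑ˡ x)
                                (maxDegIn-≥ (G₁ ⋁ G₂) (∈-++-↑ˡ⁺ S₁ S₂ x∈))

    degIn-⋁-↑ʳ-≤ : ∀ {y} → y ∈ S₂ → ∣ S₁ ∣ + degIn G₂ S₂ y ≤ maxDegIn (G₁ ⋁ G₂) (S₁ ++ S₂)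
    degIn-⋁-↑ʳ-≤ {y} y∈ = subst (_≤ maxDegIn (G₁ ⋁ G₂) (S₁ ++ S₂)) (degIn-⋁-↑ʳ y)
                                (maxDegIn-≥ (G₁ ⋁ G₂) (∈-++-↑ʳ⁺ S₁ S₂ y∈))

    maxDegIn-⋁-≥ˡ : maxDegIn G₁ S₁ ≤ maxDegIn (G₁ ⋁ G₂) (S₁ ++ S₂)
    maxDegIn-⋁-≥ˡ = maxDegIn-lub G₁ λ x∈ → ≤-trans (m≤m+n _ _) (degIn-⋁-↑ˡ-≤ x∈)

    maxDegIn-⋁-≥ʳ : maxDegIn G₂ S₂ ≤ maxDegIn (G₁ ⋁ G₂) (S₁ ++ S₂)
    maxDegIn-⋁-≥ʳ = maxDegIn-lub G₂ λ y∈ → ≤-trans (m≤n+m _ _) (degIn-⋁-↑ʳ-≤ y∈)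

    maxDegIn-⋁ : Nonempty S₁ → Nonempty S₂ →
                 maxDegIn (G₁ ⋁ G₂) (S₁ ++ S₂)
                   ≡ (maxDegIn G₁ S₁ + ∣ S₂ ∣) ⊔ (∣ S₁ ∣ + maxDegIn G₂ S₂)
    maxDegIn-⋁ ne₁ ne₂ = ≤-antisym
      (maxDegIn-⋁-lub (λ x∈ → ≤-trans (+-monoˡ-≤ _ (maxDegIn-≥ G₁ x∈)) (m≤m⊔n _ _))
                      (λ y∈ → ≤-trans (+-monoʳ-≤ _ (maxDegIn-≥ G₂ y∈)) (m≤n⊔m _ _)))
      (⊔-lub (attainedˡ (maxDegIn-attained G₁ ne₁)) (attainedʳ (maxDegIn-attained G₂ ne₂)))
      where
      attainedˡ : ∃[ x ] x ∈ S₁ × maxDegIn G₁ S₁ ≡ degIn G₁ S₁ x →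
                  maxDegIn G₁ S₁ + ∣ S₂ ∣ ≤ maxDegIn (G₁ ⋁ G₂) (S₁ ++ S₂)
      attainedˡ (x , x∈ , Δ≡) =
        subst (λ d → d + ∣ S₂ ∣ ≤ maxDegIn (G₁ ⋁ G₂) (S₁ ++ S₂)) (sym Δ≡) (degIn-⋁-↑ˡ-≤ x∈)
      attainedʳ : ∃[ y ] y ∈ S₂ × maxDegIn G₂ S₂ ≡ degIn G₂ S₂ y →
                  ∣ S₁ ∣ + maxDegIn G₂ S₂ ≤ maxDegIn (G₁ ⋁ G₂) (S₁ ++ S₂)
      attainedʳ (y , y∈ , Δ≡) =
        subst (λ d → ∣ S₁ ∣ + d ≤ maxDegIn (G₁ ⋁ G₂) (S₁ ++ S₂)) (sym Δ≡) (degIn-⋁-↑ʳ-≤ y∈)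

  maxDegIn-⋁-⊥ʳ : ∀ S₁ → maxDegIn (G₁ ⋁ G₂) (S₁ ++ ⊥) ≡ maxDegIn G₁ S₁
  maxDegIn-⋁-⊥ʳ S₁ = ≤-antisym
    (maxDegIn-⋁-lub S₁ ⊥
      (λ {x} x∈ → subst (_≤ maxDegIn G₁ S₁) (sym (+∣⊥∣ (degIn G₁ S₁ x))) (maxDegIn-≥ G₁ x∈))
      (λ y∈ → contradiction y∈ ∉⊥))
    (maxDegIn-⋁-≥ˡ S₁ ⊥)
    where
    +∣⊥∣ : ∀ d → d + ∣ ⊥ {n₂} ∣ ≡ d
    +∣⊥∣ d = trans (cong (d +_) (∣⊥∣≡0 n₂)) (+-identityʳ d)

  maxDegIn-⋁-⊥ˡ : ∀ S₂ → maxDegIn (G₁ ⋁ G₂) (⊥ ++ S₂) ≡ maxDegIn G₂ S₂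
  maxDegIn-⋁-⊥ˡ S₂ = ≤-antisym
    (maxDegIn-⋁-lub ⊥ S₂
      (λ x∈ → contradiction x∈ ∉⊥)
      (λ {y} y∈ → subst (_≤ maxDegIn G₂ S₂) (sym (∣⊥∣+ (degIn G₂ S₂ y))) (maxDegIn-≥ G₂ y∈)))
    (maxDegIn-⋁-≥ʳ ⊥ S₂)
    where
    ∣⊥∣+ : ∀ d → ∣ ⊥ {n₁} ∣ + d ≡ d
    ∣⊥∣+ d = cong (_+ d) (∣⊥∣≡0 n₁)

  module _ (S₁ : Subset n₁) (S₂ : Subset n₂) (indep : Independent (G₁ ⋁ G₂) (S₁ ++ S₂)) where

    Independent-⋁⁻ˡ : Independent G₁ S₁
    Independent-⋁⁻ˡ {u} {v} u∈ v∈ =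
      trans (sym (adj-⋁-↑ˡ↑ˡ u v)) (indep (∈-++-↑ˡ⁺ S₁ S₂ u∈) (∈-++-↑ˡ⁺ S₁ S₂ v∈))

    Independent-⋁⁻ʳ : Independent G₂ S₂
    Independent-⋁⁻ʳ {u} {v} u∈ v∈ =
      trans (sym (adj-⋁-↑ʳ↑ʳ u v)) (indep (∈-++-↑ʳ⁺ S₁ S₂ u∈) (∈-++-↑ʳ⁺ S₁ S₂ v∈))

    Independent-⋁⇒Empty : Empty S₁ ⊎ Empty S₂
    Independent-⋁⇒Empty with nonempty? S₁ | nonempty? S₂
    ... | yes (x , x∈) | yes (y , y∈) =
      contradiction (trans (sym (adj-⋁-↑ˡ↑ʳ x y)) (indep (∈-++-↑ˡ⁺ S₁ S₂ x∈) (∈-++-↑ʳ⁺ S₁ S₂ y∈)))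
                    λ ()
    ... | no empty₁ | _        = inj₁ empty₁
    ... | yes _     | no empty₂ = inj₂ empty₂

  Independent-⋁⁺ˡ : ∀ {S₁} → Independent G₁ S₁ → Independent (G₁ ⋁ G₂) (S₁ ++ ⊥)
  Independent-⋁⁺ˡ {S₁} indep {u} {v} u∈ v∈ with ↑-view {n₁} {n₂} u | ↑-view {n₁} {n₂} v
  ... | inj₁ (x , refl) | inj₁ (y , refl) =
    trans (adj-⋁-↑ˡ↑ˡ x y) (indep (∈-++-↑ˡ⁻ S₁ ⊥ u∈) (∈-++-↑ˡ⁻ S₁ ⊥ v∈))
  ... | inj₂ (y , refl) | _               = contradiction (∈-++-↑ʳ⁻ S₁ ⊥ u∈) ∉⊥
  ... | inj₁ _          | inj₂ (y , refl) = contradiction (∈-++-↑ʳ⁻ S₁ ⊥ v∈) ∉⊥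

  Independent-⋁⁺ʳ : ∀ {S₂} → Independent G₂ S₂ → Independent (G₁ ⋁ G₂) (⊥ ++ S₂)
  Independent-⋁⁺ʳ {S₂} indep {u} {v} u∈ v∈ with ↑-view {n₁} {n₂} u | ↑-view {n₁} {n₂} v
  ... | inj₂ (x , refl) | inj₂ (y , refl) =
    trans (adj-⋁-↑ʳ↑ʳ x y) (indep (∈-++-↑ʳ⁻ ⊥ S₂ u∈) (∈-++-↑ʳ⁻ ⊥ S₂ v∈))
  ... | inj₁ (x , refl) | _               = contradiction (∈-++-↑ˡ⁻ ⊥ S₂ u∈) ∉⊥
  ... | inj₂ _          | inj₁ (x , refl) = contradiction (∈-++-↑ˡ⁻ ⊥ S₂ v∈) ∉⊥

  α-⋁ : α (G₁ ⋁ G₂) ≡ α G₁ ⊔ α G₂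
  α-⋁ = ≤-antisym α-⋁-≤ (⊔-lub α₁-≤ α₂-≤)
    where
    α-⋁-≤ : α (G₁ ⋁ G₂) ≤ α G₁ ⊔ α G₂
    α-⋁-≤ with α-attained (G₁ ⋁ G₂)
    ... | W , indep , ∣W∣≡α with Vec.splitAt n₁ W
    ...   | W₁ , W₂ , refl = begin
      α (G₁ ⋁ G₂)       ≡⟨ ∣W∣≡α ⟨
      ∣ W₁ ++ W₂ ∣      ≡⟨ ∣p++q∣≡∣p∣+∣q∣ W₁ W₂ ⟩
      ∣ W₁ ∣ + ∣ W₂ ∣   ≡⟨ m≡0⊎n≡0⇒m+n≡m⊔n
                             (Sum.map Empty⇒∣p∣≡0 Empty⇒∣p∣≡0 (Independent-⋁⇒Empty W₁ W₂ indep)) ⟩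
      ∣ W₁ ∣ ⊔ ∣ W₂ ∣   ≤⟨ ⊔-mono-≤ (α-≥ G₁ (Independent-⋁⁻ˡ W₁ W₂ indep))
                                    (α-≥ G₂ (Independent-⋁⁻ʳ W₁ W₂ indep)) ⟩
      α G₁ ⊔ α G₂       ∎
      where open ≤-Reasoning

    α₁-≤ : α G₁ ≤ α (G₁ ⋁ G₂)
    α₁-≤ with α-attained G₁
    ... | I , indep , ∣I∣≡α =
      subst (_≤ α (G₁ ⋁ G₂)) (trans (∣p++⊥∣≡∣p∣ I) ∣I∣≡α) (α-≥ (G₁ ⋁ G₂) (Independent-⋁⁺ˡ indep))

    α₂-≤ : α G₂ ≤ α (G₁ ⋁ G₂)
    α₂-≤ with α-attained G₂
    ... | I , indep , ∣I∣≡α =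
      subst (_≤ α (G₁ ⋁ G₂)) (trans (∣⊥++q∣≡∣q∣ {n₁} I) ∣I∣≡α) (α-≥ (G₁ ⋁ G₂) (Independent-⋁⁺ʳ indep))

module JoinSensitivity {n₁ n₂} (G₁ : Graph n₁) (G₂ : Graph n₂) (α₂≤α₁ : α G₂ ≤ α G₁) where
  open Join G₁ G₂

  α₁ α₂ : ℕ
  α₁ = α G₁
  α₂ = α G₂

  b c : ℕ → ℕ∞
  b j = fin (j ⊔ (suc α₁ ∸ j))
  c j = max∞ (fin j) (fin (suc α₁ ∸ j) +∞ σₖ (j ∸ α₂) G₂)

  b≡c : ∀ {j} → j ≤ α₂ → b j ≡ c j
  b≡c {j} j≤α₂ rewrite m≤n⇒m∸n≡0 j≤α₂ = cong (λ k → fin (j ⊔ k)) (sym (+-identityʳ _))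

  α-⋁≡α₁ : α (G₁ ⋁ G₂) ≡ α₁
  α-⋁≡α₁ = trans α-⋁ (m≥n⇒m⊔n≡m α₂≤α₁)

  σ-⋁-≤ : ∀ S → α₁ < ∣ S ∣ → σ (G₁ ⋁ G₂) ≤∞ fin (maxDegIn (G₁ ⋁ G₂) S)
  σ-⋁-≤ S α₁<∣S∣ = σ-≤ (G₁ ⋁ G₂) S (subst (_< ∣ S ∣) (sym α-⋁≡α₁) α₁<∣S∣)

  σ-⋁-≤-σ₁ : σ (G₁ ⋁ G₂) ≤∞ σ G₁
  σ-⋁-≤-σ₁ = σ-glb G₁ λ S α₁<∣S∣ →
    ≤∞-trans (σ-⋁-≤ (S ++ ⊥) (subst (α₁ <_) (sym (∣p++⊥∣≡∣p∣ S)) α₁<∣S∣))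
             (≤∞-reflexive (cong fin (maxDegIn-⋁-⊥ʳ S)))

  σ-⋁-≤-σₖ₂ : σ (G₁ ⋁ G₂) ≤∞ σₖ (suc α₁ ∸ α₂) G₂
  σ-⋁-≤-σₖ₂ with σₖ (suc α₁ ∸ α₂) G₂ in σₖ≡
  ... | ∞     = ≤∞-top
  ... | fin m with σₖ-∸α-attained G₂ (suc α₁) σₖ≡
  ...   | T , ∣T∣≡ , Δ≡m =
    ≤∞-trans (σ-⋁-≤ (⊥ ++ T) (≤-reflexive (sym (trans (∣⊥++q∣≡∣q∣ {n₁} T) ∣T∣≡))))
             (≤∞-reflexive (cong fin (trans (maxDegIn-⋁-⊥ˡ T) Δ≡m)))

  σ-⋁-≤-c : ∀ {j} → 1 ≤ j → j ≤ α₁ → σ (G₁ ⋁ G₂) ≤∞ c j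
  σ-⋁-≤-c {j} 1≤j j≤α₁ with σₖ (j ∸ α₂) G₂ in σₖ≡
  ... | ∞     = ≤∞-top
  ... | fin m with σₖ-∸α-attained G₂ j σₖ≡ | Independent-ofSize G₁ (∸-monoʳ-≤ (suc α₁) 1≤j)
  ...   | T , ∣T∣≡j , Δ₂≡m | A , indepA , ∣A∣≡ =
    ≤∞-trans (σ-⋁-≤ (A ++ T) (≤-reflexive (sym ∣A++T∣≡))) (≤∞-reflexive (cong fin Δ≡))
    where
    open ≡-Reasoning
    ∣A++T∣≡ : ∣ A ++ T ∣ ≡ suc α₁
    ∣A++T∣≡ = begin
      ∣ A ++ T ∣          ≡⟨ ∣p++q∣≡∣p∣+∣q∣ A T ⟩
      ∣ A ∣ + ∣ T ∣       ≡⟨ cong₂ _+_ ∣A∣≡ ∣T∣≡j ⟩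
      (suc α₁ ∸ j) + j    ≡⟨ m∸n+n≡m (m≤n⇒m≤1+n j≤α₁) ⟩
      suc α₁              ∎
    nonemptyA : Nonempty A
    nonemptyA = 0<∣p∣⇒Nonempty (subst (0 <_) (sym ∣A∣≡) (0<1+m∸n j≤α₁))
    nonemptyT : Nonempty T
    nonemptyT = 0<∣p∣⇒Nonempty (subst (0 <_) (sym ∣T∣≡j) 1≤j)
    Δ≡ : maxDegIn (G₁ ⋁ G₂) (A ++ T) ≡ j ⊔ ((suc α₁ ∸ j) + m)
    Δ≡ = begin
      maxDegIn (G₁ ⋁ G₂) (A ++ T)
        ≡⟨ maxDegIn-⋁ A T nonemptyA nonemptyT ⟩
      (maxDegIn G₁ A + ∣ T ∣) ⊔ (∣ A ∣ + maxDegIn G₂ T)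
        ≡⟨ cong₂ (λ d k → (d + k) ⊔ _) (maxDegIn-Independent G₁ indepA) ∣T∣≡j ⟩
      j ⊔ (∣ A ∣ + maxDegIn G₂ T)
        ≡⟨ cong₂ (λ a d → j ⊔ (a + d)) ∣A∣≡ Δ₂≡m ⟩
      j ⊔ ((suc α₁ ∸ j) + m)
        ∎

  σ-⋁-≤-b : ∀ {j} → 1 ≤ j → j ≤ α₂ → σ (G₁ ⋁ G₂) ≤∞ b j
  σ-⋁-≤-b 1≤j j≤α₂ = subst (σ (G₁ ⋁ G₂) ≤∞_) (sym (b≡c j≤α₂)) (σ-⋁-≤-c 1≤j (≤-trans j≤α₂ α₂≤α₁))

  σ-⋁-≤-minRange-b : σ (G₁ ⋁ G₂) ≤∞ minRange 1 α₂ b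
  σ-⋁-≤-minRange-b = minRange-glb 1 α₂ b λ _ → σ-⋁-≤-b

  σ-⋁-≤-minRange-c : ∀ {m} → m ≤ α₁ → σ (G₁ ⋁ G₂) ≤∞ minRange (suc α₂) m c
  σ-⋁-≤-minRange-c {m} m≤α₁ =
    minRange-glb (suc α₂) m c λ _ α₂<j j≤m → σ-⋁-≤-c (≤-trans (s≤s z≤n) α₂<j) (≤-trans j≤m m≤α₁)

  minRange-b⊓c-≤ : ∀ {j m} → 1 ≤ j → j ≤ m → min∞ (minRange 1 α₂ b) (minRange (suc α₂) m c) ≤∞ c j
  minRange-b⊓c-≤ {j} {m} 1≤j j≤m with j ≤? α₂
  ... | yes j≤α₂ =
    ≤∞-trans (min∞-≤ˡ _ _) (subst (minRange 1 α₂ b ≤∞_) (b≡c j≤α₂) (minRange-≤ b 1≤j j≤α₂))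
  ... | no  j≰α₂ = ≤∞-trans (min∞-≤ʳ _ _) (minRange-≤ c (≰⇒> j≰α₂) j≤m)

  module _ (S₁ : Subset n₁) (S₂ : Subset n₂) where

    σ₁-≤-maxDegIn-⋁ : α₁ < ∣ S₁ ∣ → σ G₁ ≤∞ fin (maxDegIn (G₁ ⋁ G₂) (S₁ ++ S₂))
    σ₁-≤-maxDegIn-⋁ α₁<∣S₁∣ = ≤∞-trans (σ-≤ G₁ S₁ α₁<∣S₁∣) (fin≤fin (maxDegIn-⋁-≥ˡ S₁ S₂))

    σₖ₂-≤-maxDegIn-⋁ : α₁ < ∣ S₂ ∣ → σₖ (suc α₁ ∸ α₂) G₂ ≤∞ fin (maxDegIn (G₁ ⋁ G₂) (S₁ ++ S₂))
    σₖ₂-≤-maxDegIn-⋁ α₁<∣S₂∣ with ⊆-ofSize S₂ α₁<∣S₂∣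
    ... | T , T⊆S₂ , ∣T∣≡ =
      ≤∞-trans (subst (λ k → σₖ (k ∸ α₂) G₂ ≤∞ fin (maxDegIn G₂ T)) ∣T∣≡ (σₖ-∸α-≤ G₂ T))
               (fin≤fin (≤-trans (maxDegIn-mono G₂ T⊆S₂) (maxDegIn-⋁-≥ʳ S₁ S₂)))

    c-≤-maxDegIn-⋁ : ∣ S₂ ∣ ≤ α₁ → α₁ < ∣ S₁ ∣ + ∣ S₂ ∣ → 1 ≤ ∣ S₂ ∣ →
                     c ∣ S₂ ∣ ≤∞ fin (maxDegIn (G₁ ⋁ G₂) (S₁ ++ S₂))
    c-≤-maxDegIn-⋁ ∣S₂∣≤α₁ α₁<∣S∣ 0<∣S₂∣ =
      ≤∞-trans (max∞-monoʳ (fin ∣ S₂ ∣) (+∞-monoʳ (fin (suc α₁ ∸ ∣ S₂ ∣)) (σₖ-∸α-≤ G₂ S₂)))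
               (fin≤fin (subst (_ ≤_) (sym (maxDegIn-⋁ S₁ S₂ nonempty₁ (0<∣p∣⇒Nonempty 0<∣S₂∣)))
                               (⊔-mono-≤ (m≤n+m _ _) (+-monoˡ-≤ _ 1+α₁∸∣S₂∣≤∣S₁∣))))
      where
      1+α₁∸∣S₂∣≤∣S₁∣ : suc α₁ ∸ ∣ S₂ ∣ ≤ ∣ S₁ ∣
      1+α₁∸∣S₂∣≤∣S₁∣ = m≤n+o⇒m∸n≤o (suc α₁) ∣ S₂ ∣ (subst (α₁ <_) (+-comm ∣ S₁ ∣ ∣ S₂ ∣) α₁<∣S∣)
      nonempty₁ : Nonempty S₁
      nonempty₁ = 0<∣p∣⇒Nonempty (≤-trans (0<1+m∸n ∣S₂∣≤α₁) 1+α₁∸∣S₂∣≤∣S₁∣)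

  σ-⋁-glb : ∀ {z} → z ≤∞ σ G₁ → (∀ {j} → 1 ≤ j → j ≤ α₁ → j ≤ n₂ → z ≤∞ c j) →
            (α₁ < n₂ → z ≤∞ σₖ (suc α₁ ∸ α₂) G₂) → z ≤∞ σ (G₁ ⋁ G₂)
  σ-⋁-glb {z} z≤σ₁ z≤c z≤σₖ₂ = σ-glb (G₁ ⋁ G₂) bound
    where
    boundSplit : ∀ S₁ S₂ → α₁ < ∣ S₁ ∣ + ∣ S₂ ∣ → z ≤∞ fin (maxDegIn (G₁ ⋁ G₂) (S₁ ++ S₂))
    boundSplit S₁ S₂ α₁<∣S∣ with α₁ <? ∣ S₁ ∣ | α₁ <? ∣ S₂ ∣
    ... | yes α₁<∣S₁∣ | _           = ≤∞-trans z≤σ₁ (σ₁-≤-maxDegIn-⋁ S₁ S₂ α₁<∣S₁∣)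
    ... | no  _       | yes α₁<∣S₂∣ =
      ≤∞-trans (z≤σₖ₂ (<-≤-trans α₁<∣S₂∣ (∣p∣≤n S₂))) (σₖ₂-≤-maxDegIn-⋁ S₁ S₂ α₁<∣S₂∣)
    ... | no  α₁≮∣S₁∣ | no  α₁≮∣S₂∣ =
      ≤∞-trans (z≤c 1≤∣S₂∣ ∣S₂∣≤α₁ (∣p∣≤n S₂)) (c-≤-maxDegIn-⋁ S₁ S₂ ∣S₂∣≤α₁ α₁<∣S∣ 1≤∣S₂∣)
      where
      ∣S₂∣≤α₁ = ≮⇒≥ α₁≮∣S₂∣
      1≤∣S₂∣ : 1 ≤ ∣ S₂ ∣
      1≤∣S₂∣ = m<n+o∧n≤m⇒0<o α₁<∣S∣ (≮⇒≥ α₁≮∣S₁∣)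

    bound : ∀ S → α (G₁ ⋁ G₂) < ∣ S ∣ → z ≤∞ fin (maxDegIn (G₁ ⋁ G₂) S)
    bound S α<∣S∣ with Vec.splitAt n₁ S
    ... | S₁ , S₂ , refl = boundSplit S₁ S₂ (subst₂ _<_ α-⋁≡α₁ (∣p++q∣≡∣p∣+∣q∣ S₁ S₂) α<∣S∣)

theorem3p1 : ∀ {n₁ n₂} (G₁ : Graph n₁) (G₂ : Graph n₂) → α G₁ ≥ α G₂ →
    let α₁ = α G₁
        α₂ = α G₂
        b  = λ (j : ℕ) → fin (j ⊔ (suc α₁ ∸ j))
        c  = λ (j : ℕ) → max∞ (fin j) (fin (suc α₁ ∸ j) +∞ σₖ (j ∸ α₂) G₂)
    in (n₂ ≤ α₁ →
          σ (G₁ ⋁ G₂) ≡ min∞ (σ G₁) (min∞ (minRange 1 α₂ b) (minRange (suc α₂) n₂ c)))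
     × (n₂ ≥ α₁ →
          σ (G₁ ⋁ G₂) ≡ min∞ (σ G₁) (min∞ (minRange 1 α₂ b)
                           (min∞ (minRange (suc α₂) α₁ c) (σₖ (suc α₁ ∸ α₂) G₂))))
theorem3p1 {n₁} {n₂} G₁ G₂ α₂≤α₁ = part₁ , part₂
  where
  open JoinSensitivity G₁ G₂ α₂≤α₁

  B : ℕ∞
  B = minRange 1 α₂ b

  C : ℕ → ℕ∞
  C m = minRange (suc α₂) m c

  D : ℕ∞
  D = σₖ (suc α₁ ∸ α₂) G₂

  part₁ : n₂ ≤ α₁ → σ (G₁ ⋁ G₂) ≡ min∞ (σ G₁) (min∞ B (C n₂))
  part₁ n₂≤α₁ = ≤∞-antisym
    (min∞-glb σ-⋁-≤-σ₁ (min∞-glb σ-⋁-≤-minRange-b (σ-⋁-≤-minRange-c n₂≤α₁)))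
    (σ-⋁-glb (min∞-≤ˡ (σ G₁) (min∞ B (C n₂)))
             (λ 1≤j _ j≤n₂ → ≤∞-trans (min∞-≤ʳ (σ G₁) (min∞ B (C n₂))) (minRange-b⊓c-≤ 1≤j j≤n₂))
             (λ α₁<n₂ → contradiction n₂≤α₁ (<⇒≱ α₁<n₂)))

  part₂ : α₁ ≤ n₂ → σ (G₁ ⋁ G₂) ≡ min∞ (σ G₁) (min∞ B (min∞ (C α₁) D))
  part₂ _ = ≤∞-antisym
    (min∞-glb σ-⋁-≤-σ₁ (min∞-glb σ-⋁-≤-minRange-b (min∞-glb (σ-⋁-≤-minRange-c ≤-refl) σ-⋁-≤-σₖ₂)))
    (σ-⋁-glb (min∞-≤ˡ (σ G₁) (min∞ B (min∞ (C α₁) D)))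
             (λ 1≤j j≤α₁ _ → ≤∞-trans (≤∞-trans (min∞-≤ʳ (σ G₁) (min∞ B (min∞ (C α₁) D)))
                                                (min∞-monoʳ B (min∞-≤ˡ (C α₁) D)))
                                      (minRange-b⊓c-≤ 1≤j j≤α₁))
             (λ _ → ≤∞-trans (min∞-≤ʳ (σ G₁) (min∞ B (min∞ (C α₁) D)))
                             (≤∞-trans (min∞-≤ʳ B (min∞ (C α₁) D)) (min∞-≤ʳ (C α₁) D))))
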